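{- For $n\ge0$ let \[C_n(x,z)=\sum_{T\in\mathcal P_n}x^{c(T)}z^{u(T)},\] where $\mathcal P_n$ is the set of permutation tableaux of length $n$, $c(T)$ is the number of corners of $T$ and $u(T)$ is the number of unrestricted rows of $T$ (with the convention $C_0(x,z)=1$). Then $C_1(x,z)=z$ and for all $n\ge 2$ \[C_n(x,z)=zC_{n-1}(x,z+1)+(x-1)\Big(z(z+1)C_{n-2}(x,z+1)-z^2C_{n-2}(x,z)\Big).\]
   Context: A Ferrers diagram is a top- and left-justified arrangement of cells in rows whose numbers of cells are weakly decreasing from top to bottom; some rows (at the bottom) may be empty. Its length is its number of columns plus its number of rows (empty rows included). The southeast border is the lattice path from the top-right end to the bottom-left end along the boundary, with one south step per row (an empty row gives a south step along the left edge) and one west step per column. A permutation tableau of length $n$ is a Ferrers diagram of length $n$ filled with $0$'s and $1$'s so that every column contains at least one $1$, and no $0$ has simultaneously a $1$ above it in its column and a $1$ to its left in its row. A corner is a south step immediately followed by a west step when the southeast border is traversed from northeast to southwest. A $0$ is restricted if there is a $1$ above it in its column; a row is restricted if it contains a restricted $0$, and unrestricted otherwise (in particular empty rows and the top row are unrestricted). -}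

module Defs where

open import Data.Bool using (Bool; true; false; _∧_; _∨_; not; if_then_else_)
open import Data.Nat using (ℕ; zero; suc; _∸_; _≤ᵇ_; _≡ᵇ_)
import Data.Nat as ℕ
open import Data.List using (List; []; _∷_; length; map; filter; concatMap; replicate; upTo; zip; take; _++_; foldr)
open import Data.Bool.ListAction using (any; all)
open import Data.Product using (_×_; _,_)
open import Data.Integer using (ℤ; _^_; _*_; _+_)
import Data.Integer as ℤ
open import Relation.Nullary.Decidable using (Dec; yes; no)
open import Relation.Binary.PropositionalEquality using (_≡_)
open import Data.Bool using (T)
open import Data.Bool.Properties using (T?)

-- A filled Ferrers diagram is a list of rows (top to bottom); each row is
-- a list of entries (left to right), with true = 1 and false = 0.
-- Cells are left-justified; (i , j) = row i, column j (0-based).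
-- The shape is the list of row lengths; empty rows are allowed.

Filling : Set
Filling = List (List Bool)

shape : Filling → List ℕ
shape = map length

weaklyDecreasing : List ℕ → Bool
weaklyDecreasing []           = true
weaklyDecreasing (a ∷ [])     = true
weaklyDecreasing (a ∷ b ∷ xs) = (b ≤ᵇ a) ∧ weaklyDecreasing (b ∷ xs)

nrows : Filling → ℕ
nrows = length

-- number of columns = length of the top row (diagram is top-justified)
ncols : Filling → ℕ
ncols []      = 0
ncols (r ∷ _) = length r

diagLength : Filling → ℕ
diagLength T = nrows T ℕ.+ ncols T

-- entry of a row at column j (false if the cell does not exist; only
-- used on existing cells or to test for the presence of a 1)
at : List Bool → ℕ → Bool
at []       _       = false
at (b ∷ _)  zero    = b
at (_ ∷ bs) (suc j) = at bs j

indexed : {A : Set} → List A → List (ℕ × A)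
indexed xs = zip (upTo (length xs)) xs

oneInColumn : List (List Bool) → ℕ → Bool
oneInColumn rows j = any (λ r → at r j) rows

oneLeftOf : List Bool → ℕ → Bool
oneLeftOf row j = any (λ b → b) (take j row)

columnsOK : Filling → Bool
columnsOK T = all (λ j → oneInColumn T j) (upTo (ncols T))

-- the "no 0 with a 1 above it in its column and a 1 to its left in its
-- row" condition, checked row by row; `above` = rows strictly above.
zeroRuleRows : List (List Bool) → Filling → Bool
zeroRuleRows above []         = true
zeroRuleRows above (r ∷ rows) =
  all (λ { (j , b) → b ∨ not (oneInColumn above j ∧ oneLeftOf r j) }) (indexed r)
  ∧ zeroRuleRows (above ++ (r ∷ [])) rows

isPermTableau : ℕ → Filling → Bool
isPermTableau n T =
  weaklyDecreasing (shape T) ∧ (diagLength T ≡ᵇ n) ∧ columnsOK T ∧ zeroRuleRows [] T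

data Step : Set where
  S W : Step

-- Border from the top-right end to the bottom-left end: for each row
-- (top to bottom) a south step along its right end, followed by the west
-- steps down to the length of the next row (0 after the last row).
borderFrom : List ℕ → List Step
borderFrom []           = []
borderFrom (a ∷ [])     = S ∷ replicate a W
borderFrom (a ∷ b ∷ xs) = S ∷ replicate (a ∸ b) W ++ borderFrom (b ∷ xs)

border : Filling → List Step
border T = borderFrom (shape T)

countSW : List Step → ℕ
countSW []           = 0
countSW (S ∷ W ∷ xs) = suc (countSW (W ∷ xs))
countSW (_ ∷ xs)     = countSW xs

corners : Filling → ℕ
corners T = countSW (border T)

hasRestrictedZero : List (List Bool) → List Bool → Bool
hasRestrictedZero above r =
  any (λ { (j , b) → not b ∧ oneInColumn above j }) (indexed r)

unrestrictedRowsFrom : List (List Bool) → Filling → ℕ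
unrestrictedRowsFrom above []         = 0
unrestrictedRowsFrom above (r ∷ rows) =
  (if hasRestrictedZero above r then 0 else 1)
  ℕ.+ unrestrictedRowsFrom (above ++ (r ∷ [])) rows

unrestrictedRows : Filling → ℕ
unrestrictedRows T = unrestrictedRowsFrom [] T

-- A permutation tableau of length n has at most n
-- rows, each of length at most n; we enumerate all such fillings (each
-- exactly once) and keep those that are permutation tableaux.

listsOfLength : {A : Set} → List A → ℕ → List (List A)
listsOfLength xs zero    = [] ∷ []
listsOfLength xs (suc k) = concatMap (λ x → map (x ∷_) (listsOfLength xs k)) xs

listsUpTo : {A : Set} → List A → ℕ → List (List A)
listsUpTo xs m = concatMap (listsOfLength xs) (upTo (suc m))

candidates : ℕ → List Filling
candidates n = listsUpTo (listsUpTo (true ∷ false ∷ []) n) n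

permTableaux : ℕ → List Filling
permTableaux n = filter (λ T → T? (isPermTableau n T)) (candidates n)

sumℤ : List ℤ → ℤ
sumℤ = foldr _+_ (ℤ.+ 0)

C : ℕ → ℤ → ℤ → ℤ
C n x z = sumℤ (map (λ T → (x ^ corners T) * (z ^ unrestrictedRows T)) (permTableaux n))

-- A permutation tableau of length n + 1 arises in exactly one way from one of
-- length n: either by adding an empty bottom row, or by adding a new first
-- column that contains a 1 and has its 1s only in unrestricted rows.  An empty
-- row adds one unrestricted row and no corner.  A new column adds a corner
-- exactly when the old bottom row is empty, and summing z^(unrestricted rows)
-- over its admissible fillings gives z(z+1)^u - z z^u.  Hence
--   C_{n+1}(x,z) = z C_n(x,z+1) + (x-1) sum over T with empty bottom row of
--                  x^c(T) (z(z+1)^u(T) - z z^u(T)),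
-- and the tableaux of length n with empty bottom row are exactly those
-- obtained from tableaux of length n-1 by adding an empty row.

module Submission where

open import Defs
open import Algebra.Bundles using (CommutativeMonoid)
import Algebra.Properties.CommutativeSemigroup as CommutativeSemigroupProperties
open import Data.Bool using (Bool; true; false; _∧_; _∨_; not; if_then_else_)
open import Data.Bool.ListAction using (any; all; or; and)
import Data.Bool.Properties as Bool
open import Data.Bool.Properties using (T?)
open import Data.Empty using (⊥; ⊥-elim)
open import Data.Integer using (ℤ; _+_; _*_; -_; _-_; +_; _^_)
import Data.Integer.Properties as ℤ
open import Data.Integer.Tactic.RingSolver using (solve-∀)
open import Data.List using (List; []; _∷_; _∷ʳ_; drop; map; _++_; concatMap; length; upTo; applyUpTo; zip; replicate; head)
import Data.List.Properties as List
open import Data.List.Membership.Propositional using (_∈_; _∉_; find; lose)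
open import Data.List.Membership.Propositional.Properties
open import Data.List.Membership.Propositional.Properties.WithK using (unique∧set⇒bag)
open import Data.List.Relation.Binary.BagAndSetEquality using (∼bag⇒↭)
open import Data.List.Relation.Binary.Permutation.Propositional using (_↭_; ↭⇒↭ₛ)
import Data.List.Relation.Binary.Permutation.Propositional.Properties as ↭
open import Data.List.Relation.Binary.Permutation.Setoid.Properties using (foldr-commMonoid)
open import Data.List.Relation.Unary.All as All using (All; []; _∷_)
open import Data.List.Relation.Unary.All.Properties using () renaming (map⁺ to All-map⁺; map⁻ to All-map⁻)
open import Data.List.Relation.Unary.Any using (here; there)
open import Data.List.Relation.Unary.Unique.Propositional using (Unique)
open import Data.List.Relation.Unary.AllPairs using ([]; _∷_)
import Data.List.Relation.Unary.Unique.Propositional.Properties as Unique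
open import Data.Nat using (ℕ; zero; suc; _≤_; s≤s; z≤n; _≤ᵇ_; _≡ᵇ_)
import Data.Nat as ℕ
import Data.Nat.Properties as ℕ
open import Data.Maybe using (just)
import Data.Maybe.Properties as Maybe
open import Data.Product using (_×_; _,_; proj₁; proj₂; Σ; map₁)
open import Data.Sum using (inj₁; inj₂)
open import Function using (_∘_; id)
open import Function.Bundles using (mk⇔; Equivalence)
open import Relation.Binary.PropositionalEquality

+-interchange : ∀ a b c d → (a + b) + (c + d) ≡ (a + c) + (b + d)
+-interchange = CommutativeSemigroupProperties.interchange ℤ.+-commutativeSemigroup

∑ : {A : Set} → (A → ℤ) → List A → ℤ
∑ w xs = sumℤ (map w xs)

module _ {A : Set} where

  ∑-++ : (w : A → ℤ) (xs ys : List A) → ∑ w (xs ++ ys) ≡ ∑ w xs + ∑ w ys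
  ∑-++ w []       ys = sym (ℤ.+-identityˡ _)
  ∑-++ w (x ∷ xs) ys = trans (cong (_+_ (w x)) (∑-++ w xs ys)) (sym (ℤ.+-assoc (w x) _ _))

  ∑-cong : {v w : A → ℤ} (xs : List A) → (∀ {a} → a ∈ xs → v a ≡ w a) → ∑ v xs ≡ ∑ w xs
  ∑-cong []       _  = refl
  ∑-cong (x ∷ xs) eq = cong₂ _+_ (eq (here refl)) (∑-cong xs (eq ∘ there))

  ∑-+ : (v w : A → ℤ) (xs : List A) → ∑ (λ a → v a + w a) xs ≡ ∑ v xs + ∑ w xs
  ∑-+ v w []       = refl
  ∑-+ v w (x ∷ xs) = trans (cong (_+_ (v x + w x)) (∑-+ v w xs)) (+-interchange (v x) (w x) _ _)

  ∑-*ˡ : (k : ℤ) (w : A → ℤ) (xs : List A) → ∑ (λ a → k * w a) xs ≡ k * ∑ w xs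
  ∑-*ˡ k w []       = sym (ℤ.*-zeroʳ k)
  ∑-*ˡ k w (x ∷ xs) = trans (cong (_+_ (k * w x)) (∑-*ˡ k w xs)) (sym (ℤ.*-distribˡ-+ k (w x) _))

  ∑-zero : (xs : List A) → ∑ (λ _ → + 0) xs ≡ + 0
  ∑-zero []       = refl
  ∑-zero (x ∷ xs) = trans (ℤ.+-identityˡ _) (∑-zero xs)

  ∑-↭ : (w : A → ℤ) {xs ys : List A} → xs ↭ ys → ∑ w xs ≡ ∑ w ys
  ∑-↭ w p = foldr-commMonoid ℤ+.setoid ℤ+.isCommutativeMonoid (↭⇒↭ₛ (↭.map⁺ w p))
    where
    module ℤ+ = CommutativeMonoid ℤ.+-0-commutativeMonoid

  ∑-unique : (w : A → ℤ) {xs ys : List A} → Unique xs → Unique ys →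
             (∀ {a} → a ∈ xs → a ∈ ys) → (∀ {a} → a ∈ ys → a ∈ xs) → ∑ w xs ≡ ∑ w ys
  ∑-unique w xs! ys! xs⊆ys ys⊆xs = ∑-↭ w (∼bag⇒↭ (unique∧set⇒bag xs! ys! (mk⇔ xs⊆ys ys⊆xs)))

module _ {A B : Set} where

  ∑-map : (w : B → ℤ) (f : A → B) (xs : List A) → ∑ w (map f xs) ≡ ∑ (λ a → w (f a)) xs
  ∑-map w f xs = cong sumℤ (sym (List.map-∘ xs))

  ∑-concatMap : (w : B → ℤ) (f : A → List B) (xs : List A) →
                ∑ w (concatMap f xs) ≡ ∑ (λ a → ∑ w (f a)) xs
  ∑-concatMap w f []       = refl
  ∑-concatMap w f (x ∷ xs) = trans (∑-++ w (f x) (concatMap f xs)) (cong (_+_ (∑ w (f x))) (∑-concatMap w f xs))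

  map-unique : (f : A → B) {xs : List A} → (∀ {x y} → x ∈ xs → y ∈ xs → f x ≡ f y → x ≡ y) →
               Unique xs → Unique (map f xs)
  map-unique f inj []            = []
  map-unique f inj (x∉xs ∷ xs!) =
    All-map⁺ (All.tabulate (λ y∈xs fx≡fy → All.lookup x∉xs y∈xs (inj (here refl) (there y∈xs) fx≡fy)))
      ∷ map-unique f (λ x∈ y∈ → inj (there x∈) (there y∈)) xs!

  concatMap-unique : (f : A → List B) {xs : List A} → Unique xs → (∀ {x} → x ∈ xs → Unique (f x)) →
                     (∀ {x x′ y} → y ∈ f x → y ∈ f x′ → x ≡ x′) → Unique (concatMap f xs)
  concatMap-unique f []            _       _        = []
  concatMap-unique f {x ∷ xs} (x∉xs ∷ xs!) f-unique disjoint =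
    Unique.++⁺ (f-unique (here refl)) (concatMap-unique f xs! (f-unique ∘ there) disjoint) separated
    where
    separated : ∀ {y} → y ∈ f x × y ∈ concatMap f xs → ⊥
    separated (y∈fx , y∈rest) with find (∈-concatMap⁻ f y∈rest)
    ... | x′ , x′∈xs , y∈fx′ = All.lookup x∉xs x′∈xs (disjoint y∈fx y∈fx′)

∧-interchange : ∀ a b c d → (a ∧ b) ∧ (c ∧ d) ≡ (a ∧ c) ∧ (b ∧ d)
∧-interchange = CommutativeSemigroupProperties.interchange (CommutativeMonoid.commutativeSemigroup Bool.∧-commutativeMonoid)

module _ {A : Set} where

  indexed-∷ : (x : A) (xs : List A) → indexed (x ∷ xs) ≡ (0 , x) ∷ map (map₁ suc) (indexed xs)
  indexed-∷ x xs = cong ((0 , x) ∷_) (shift id xs)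
    where
    shift : (f : ℕ → ℕ) (ys : List A) →
            zip (applyUpTo (suc ∘ f) (length ys)) ys ≡ map (map₁ suc) (zip (applyUpTo f (length ys)) ys)
    shift f []       = refl
    shift f (y ∷ ys) = cong ((suc (f 0) , y) ∷_) (shift (f ∘ suc) ys)

  any-indexed-∷ : (p : ℕ × A → Bool) (x : A) (xs : List A) →
                  any p (indexed (x ∷ xs)) ≡ p (0 , x) ∨ any (p ∘ map₁ suc) (indexed xs)
  any-indexed-∷ p x xs =
    trans (cong (any p) (indexed-∷ x xs)) (cong (λ b → p (0 , x) ∨ or b) (sym (List.map-∘ (indexed xs))))

  all-indexed-∷ : (p : ℕ × A → Bool) (x : A) (xs : List A) →
                  all p (indexed (x ∷ xs)) ≡ p (0 , x) ∧ all (p ∘ map₁ suc) (indexed xs)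
  all-indexed-∷ p x xs =
    trans (cong (all p) (indexed-∷ x xs)) (cong (λ b → p (0 , x) ∧ and b) (sym (List.map-∘ (indexed xs))))

  all-∧ : (f g : A → Bool) (xs : List A) → all (λ a → f a ∧ g a) xs ≡ all f xs ∧ all g xs
  all-∧ f g []       = refl
  all-∧ f g (x ∷ xs) = trans (cong ((f x ∧ g x) ∧_) (all-∧ f g xs)) (∧-interchange (f x) (g x) _ _)

  all-∨-not : (b : Bool) (h : A → Bool) (xs : List A) → all (λ a → b ∨ not (h a)) xs ≡ b ∨ not (any h xs)
  all-∨-not true  h []       = refl
  all-∨-not true  h (x ∷ xs) = all-∨-not true h xs
  all-∨-not false h []       = refl
  all-∨-not false h (x ∷ xs) with h x
  ... | true  = refl
  ... | false = all-∨-not false h xs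

or-∷ʳ : (bs : List Bool) (b : Bool) → or (bs ∷ʳ b) ≡ or bs ∨ b
or-∷ʳ []       b = Bool.∨-identityʳ b
or-∷ʳ (c ∷ bs) b = trans (cong (c ∨_) (or-∷ʳ bs b)) (sym (Bool.∨-assoc c (or bs) b))

any-∷ʳ : {A : Set} (p : A → Bool) (xs : List A) (x : A) → any p (xs ∷ʳ x) ≡ any p xs ∨ p x
any-∷ʳ p xs x = trans (cong or (List.map-++ p xs (x ∷ []))) (or-∷ʳ (map p xs) (p x))

-- A cell of an old row after a new column is added: b′ is its entry, o says
-- whether a 1 lies above it, l whether a 1 lies to its left in the old row,
-- and b is the new entry at the start of the row.
zeroRule-split : ∀ b′ o b l → b′ ∨ not (o ∧ (b ∨ l)) ≡ (b′ ∨ not (o ∧ l)) ∧ (not b ∨ not (not b′ ∧ o))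
zeroRule-split true  o     b     l = sym (Bool.∨-zeroʳ (not b))
zeroRule-split false false b     l = sym (Bool.∨-zeroʳ (not b))
zeroRule-split false true  true  l = sym (Bool.∧-zeroʳ (not l))
zeroRule-split false true  false l = sym (Bool.∧-identityʳ (not l))

∧-regroup : ∀ w d a b c e → w ∧ (d ∧ ((a ∧ b) ∧ (c ∧ e))) ≡ (w ∧ (d ∧ (b ∧ c))) ∧ (a ∧ e)
∧-regroup false d     a     b c e = refl
∧-regroup true  false a     b c e = refl
∧-regroup true  true  false b c e = sym (Bool.∧-zeroʳ (b ∧ c))
∧-regroup true  true  true  b c e = sym (Bool.∧-assoc b c e)

isRestrictedZero : Filling → ℕ × Bool → Bool
isRestrictedZero above (j , b) = not b ∧ oneInColumn above j

hasRestrictedZero-any : (above : Filling) (r : List Bool) →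
                        hasRestrictedZero above r ≡ any (isRestrictedZero above) (indexed r)
hasRestrictedZero-any above r = cong or (List.map-cong (λ { (j , b) → refl }) (indexed r))

zeroRuleAt : Filling → List Bool → ℕ × Bool → Bool
zeroRuleAt above r (j , b) = b ∨ not (oneInColumn above j ∧ oneLeftOf r j)

zeroRuleRows-∷ : (above : Filling) (r : List Bool) (rows : Filling) →
  zeroRuleRows above (r ∷ rows) ≡ all (zeroRuleAt above r) (indexed r) ∧ zeroRuleRows (above ∷ʳ r) rows
zeroRuleRows-∷ above r rows =
  cong (λ b → and b ∧ zeroRuleRows (above ∷ʳ r) rows) (List.map-cong (λ { (j , b) → refl }) (indexed r))

addColumn : List Bool → Filling → Filling
addColumn (b ∷ c) (r ∷ T) = (b ∷ r) ∷ addColumn c T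
addColumn _       _       = []

addEmptyRow : Filling → Filling
addEmptyRow T = T ∷ʳ []

-- A 1 may be put into the new first column only in rows without a restricted 0,
-- since such a 0 would then have a 1 to its left.
onesInUnrestrictedRows : Filling → List Bool → Filling → Bool
onesInUnrestrictedRows above (b ∷ c) (r ∷ rows) =
  (not b ∨ not (hasRestrictedZero above r)) ∧ onesInUnrestrictedRows (above ∷ʳ r) c rows
onesInUnrestrictedRows _ _ _ = true

length-∷ʳ : {A B : Set} (xs : List A) (ys : List B) (x : A) (y : B) →
            length xs ≡ length ys → length (xs ∷ʳ x) ≡ length (ys ∷ʳ y)
length-∷ʳ xs ys x y eq = trans (List.length-++ xs) (trans (cong (ℕ._+ 1) eq) (sym (List.length-++ ys)))

length-addColumn : (c : List Bool) (T : Filling) → length c ≡ length T → length (addColumn c T) ≡ length T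
length-addColumn []      []      _   = refl
length-addColumn (b ∷ c) (r ∷ T) len = cong suc (length-addColumn c T (ℕ.suc-injective len))

shape-addColumn : (c : List Bool) (T : Filling) → length c ≡ length T → shape (addColumn c T) ≡ map suc (shape T)
shape-addColumn []      []      _   = refl
shape-addColumn (b ∷ c) (r ∷ T) len = cong (suc (length r) ∷_) (shape-addColumn c T (ℕ.suc-injective len))

addColumn-∷ʳ : (c : List Bool) (T : Filling) (b : Bool) (r : List Bool) → length c ≡ length T →
               addColumn (c ∷ʳ b) (T ∷ʳ r) ≡ addColumn c T ∷ʳ (b ∷ r)
addColumn-∷ʳ []       []      b r _   = refl
addColumn-∷ʳ (b′ ∷ c) (r′ ∷ T) b r len = cong ((b′ ∷ r′) ∷_) (addColumn-∷ʳ c T b r (ℕ.suc-injective len))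

oneInColumn-addColumn-zero : (c : List Bool) (T : Filling) → length c ≡ length T →
                             oneInColumn (addColumn c T) 0 ≡ or c
oneInColumn-addColumn-zero []      []      _   = refl
oneInColumn-addColumn-zero (b ∷ c) (r ∷ T) len = cong (b ∨_) (oneInColumn-addColumn-zero c T (ℕ.suc-injective len))

oneInColumn-addColumn-suc : (c : List Bool) (T : Filling) (j : ℕ) → length c ≡ length T →
                            oneInColumn (addColumn c T) (suc j) ≡ oneInColumn T j
oneInColumn-addColumn-suc []      []      j _   = refl
oneInColumn-addColumn-suc (b ∷ c) (r ∷ T) j len = cong (at r j ∨_) (oneInColumn-addColumn-suc c T j (ℕ.suc-injective len))

dropColumn : Filling → Filling
dropColumn = map (drop 1)

dropColumn-addColumn : (c : List Bool) (T : Filling) → length c ≡ length T → dropColumn (addColumn c T) ≡ T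
dropColumn-addColumn []      []      _   = refl
dropColumn-addColumn (b ∷ c) (r ∷ T) len = cong (r ∷_) (dropColumn-addColumn c T (ℕ.suc-injective len))

heads-addColumn : (c : List Bool) (T : Filling) → length c ≡ length T → map head (addColumn c T) ≡ map just c
heads-addColumn []      []      _   = refl
heads-addColumn (b ∷ c) (r ∷ T) len = cong (just b ∷_) (heads-addColumn c T (ℕ.suc-injective len))

addColumn-injective : (T : Filling) {c c′ : List Bool} → length c ≡ length T → length c′ ≡ length T →
                      addColumn c T ≡ addColumn c′ T → c ≡ c′
addColumn-injective T {c} {c′} len len′ eq =
  List.map-injective Maybe.just-injective
    (trans (sym (heads-addColumn c T len)) (trans (cong (map head) eq) (heads-addColumn c′ T len′)))

hasRestrictedZero-addColumn : (c : List Bool) (T : Filling) (b : Bool) (r : List Bool) → length c ≡ length T →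
  hasRestrictedZero (addColumn c T) (b ∷ r) ≡ (not b ∧ or c) ∨ hasRestrictedZero T r
hasRestrictedZero-addColumn c T b r len =
  trans (any-indexed-∷ _ b r)
        (cong₂ _∨_ (cong (not b ∧_) (oneInColumn-addColumn-zero c T len))
                   (cong or (List.map-cong (λ { (j , b′) → cong (not b′ ∧_) (oneInColumn-addColumn-suc c T j len) }) (indexed r))))

zeroRuleRow-addColumn : (c : List Bool) (T : Filling) (b : Bool) (r : List Bool) → length c ≡ length T →
  all (zeroRuleAt (addColumn c T) (b ∷ r)) (indexed (b ∷ r))
    ≡ all (zeroRuleAt T r) (indexed r) ∧ (not b ∨ not (hasRestrictedZero T r))
zeroRuleRow-addColumn c T b r len = begin
  all (zeroRuleAt (addColumn c T) (b ∷ r)) (indexed (b ∷ r))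
    ≡⟨ all-indexed-∷ _ b r ⟩
  zeroRuleAt (addColumn c T) (b ∷ r) (0 , b) ∧ all (zeroRuleAt (addColumn c T) (b ∷ r) ∘ map₁ suc) (indexed r)
    ≡⟨ cong₂ _∧_ firstEntry (cong and (List.map-cong laterEntry (indexed r))) ⟩
  all (λ p → zeroRuleAt T r p ∧ (not b ∨ not (isRestrictedZero T p))) (indexed r)
    ≡⟨ all-∧ _ _ (indexed r) ⟩
  all (zeroRuleAt T r) (indexed r) ∧ all (λ p → not b ∨ not (isRestrictedZero T p)) (indexed r)
    ≡⟨ cong (all (zeroRuleAt T r) (indexed r) ∧_) (all-∨-not (not b) _ (indexed r)) ⟩
  all (zeroRuleAt T r) (indexed r) ∧ (not b ∨ not (any (isRestrictedZero T) (indexed r)))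
    ≡⟨ cong (λ h → all (zeroRuleAt T r) (indexed r) ∧ (not b ∨ not h)) (sym (hasRestrictedZero-any T r)) ⟩
  all (zeroRuleAt T r) (indexed r) ∧ (not b ∨ not (hasRestrictedZero T r)) ∎
  where
  open ≡-Reasoning
  firstEntry : zeroRuleAt (addColumn c T) (b ∷ r) (0 , b) ≡ true
  firstEntry = trans (cong (λ o → b ∨ not o) (Bool.∧-zeroʳ _)) (Bool.∨-zeroʳ b)
  laterEntry : ∀ p → zeroRuleAt (addColumn c T) (b ∷ r) (map₁ suc p)
                   ≡ zeroRuleAt T r p ∧ (not b ∨ not (isRestrictedZero T p))
  laterEntry (j , b′) =
    trans (cong (λ o → b′ ∨ not (o ∧ (b ∨ oneLeftOf r j))) (oneInColumn-addColumn-suc c T j len))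
          (zeroRule-split b′ (oneInColumn T j) b (oneLeftOf r j))

zeroRuleRows-addColumn : (c′ : List Bool) (above : Filling) (c : List Bool) (rows : Filling) →
  length c′ ≡ length above → length c ≡ length rows →
  zeroRuleRows (addColumn c′ above) (addColumn c rows) ≡ zeroRuleRows above rows ∧ onesInUnrestrictedRows above c rows
zeroRuleRows-addColumn c′ above []      []         _    _    = refl
zeroRuleRows-addColumn c′ above (b ∷ c) (r ∷ rows) len′ len = begin
  zeroRuleRows (addColumn c′ above) ((b ∷ r) ∷ addColumn c rows)
    ≡⟨ zeroRuleRows-∷ (addColumn c′ above) (b ∷ r) (addColumn c rows) ⟩
  all (zeroRuleAt (addColumn c′ above) (b ∷ r)) (indexed (b ∷ r)) ∧ zeroRuleRows (addColumn c′ above ∷ʳ (b ∷ r)) (addColumn c rows)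
    ≡⟨ cong₂ _∧_ (zeroRuleRow-addColumn c′ above b r len′)
                 (trans (cong (λ A → zeroRuleRows A (addColumn c rows)) (sym (addColumn-∷ʳ c′ above b r len′)))
                        (zeroRuleRows-addColumn (c′ ∷ʳ b) (above ∷ʳ r) c rows (length-∷ʳ c′ above b r len′) (ℕ.suc-injective len))) ⟩
  (all (zeroRuleAt above r) (indexed r) ∧ (not b ∨ not (hasRestrictedZero above r)))
    ∧ (zeroRuleRows (above ∷ʳ r) rows ∧ onesInUnrestrictedRows (above ∷ʳ r) c rows)
    ≡⟨ ∧-interchange (all (zeroRuleAt above r) (indexed r)) _ _ _ ⟩
  (all (zeroRuleAt above r) (indexed r) ∧ zeroRuleRows (above ∷ʳ r) rows) ∧ onesInUnrestrictedRows above (b ∷ c) (r ∷ rows)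
    ≡⟨ cong (_∧ onesInUnrestrictedRows above (b ∷ c) (r ∷ rows)) (sym (zeroRuleRows-∷ above r rows)) ⟩
  zeroRuleRows above (r ∷ rows) ∧ onesInUnrestrictedRows above (b ∷ c) (r ∷ rows) ∎
  where open ≡-Reasoning

weaklyDecreasing-map-suc : (s : List ℕ) → weaklyDecreasing (map suc s) ≡ weaklyDecreasing s
weaklyDecreasing-map-suc []          = refl
weaklyDecreasing-map-suc (a ∷ [])    = refl
weaklyDecreasing-map-suc (a ∷ b ∷ s) = cong₂ _∧_ (suc≤ᵇsuc b a) (weaklyDecreasing-map-suc (b ∷ s))
  where
  suc≤ᵇsuc : ∀ m n → (suc m ≤ᵇ suc n) ≡ (m ≤ᵇ n)
  suc≤ᵇsuc zero    n = refl
  suc≤ᵇsuc (suc m) n = refl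

columnsOK-addColumn : (b : Bool) (c : List Bool) (r : List Bool) (T : Filling) → length (b ∷ c) ≡ length (r ∷ T) →
                      columnsOK (addColumn (b ∷ c) (r ∷ T)) ≡ or (b ∷ c) ∧ columnsOK (r ∷ T)
columnsOK-addColumn b c r T len =
  cong₂ _∧_ (oneInColumn-addColumn-zero (b ∷ c) (r ∷ T) len)
            (begin
               all (oneInColumn N) (applyUpTo suc (length r))
                 ≡⟨ cong (all (oneInColumn N)) (sym (List.map-applyUpTo id suc (length r))) ⟩
               and (map (oneInColumn N) (map suc (upTo (length r))))
                 ≡⟨ cong and (sym (List.map-∘ (upTo (length r)))) ⟩
               all (oneInColumn N ∘ suc) (upTo (length r))
                 ≡⟨ cong and (List.map-cong (λ j → oneInColumn-addColumn-suc (b ∷ c) (r ∷ T) j len) (upTo (length r))) ⟩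
               columnsOK (r ∷ T) ∎)
  where
  open ≡-Reasoning
  N : Filling
  N = addColumn (b ∷ c) (r ∷ T)

isPermTableau-addColumn : (n : ℕ) (c : List Bool) (T : Filling) → length c ≡ length T →
  isPermTableau (suc n) (addColumn c T) ≡ isPermTableau n T ∧ (or c ∧ onesInUnrestrictedRows [] c T)
isPermTableau-addColumn n []      []      _   = sym (Bool.∧-zeroʳ _)
isPermTableau-addColumn n (b ∷ c) (r ∷ T) len = begin
  isPermTableau (suc n) (addColumn (b ∷ c) (r ∷ T))
    ≡⟨ cong₂ (λ w d → w ∧ (d ∧ (columnsOK N ∧ zeroRuleRows [] N))) decreasing diagonal ⟩
  weaklyDecreasing (shape (r ∷ T)) ∧ ((diagLength (r ∷ T) ≡ᵇ n) ∧ (columnsOK N ∧ zeroRuleRows [] N))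
    ≡⟨ cong₂ (λ co zr → weaklyDecreasing (shape (r ∷ T)) ∧ ((diagLength (r ∷ T) ≡ᵇ n) ∧ (co ∧ zr)))
             (columnsOK-addColumn b c r T len)
             (zeroRuleRows-addColumn [] [] (b ∷ c) (r ∷ T) refl len) ⟩
  weaklyDecreasing (shape (r ∷ T)) ∧ ((diagLength (r ∷ T) ≡ᵇ n)
    ∧ ((or (b ∷ c) ∧ columnsOK (r ∷ T)) ∧ (zeroRuleRows [] (r ∷ T) ∧ onesInUnrestrictedRows [] (b ∷ c) (r ∷ T))))
    ≡⟨ ∧-regroup (weaklyDecreasing (shape (r ∷ T))) (diagLength (r ∷ T) ≡ᵇ n) (or (b ∷ c)) _ _ _ ⟩
  isPermTableau n (r ∷ T) ∧ (or (b ∷ c) ∧ onesInUnrestrictedRows [] (b ∷ c) (r ∷ T)) ∎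
  where
  open ≡-Reasoning
  N : Filling
  N = addColumn (b ∷ c) (r ∷ T)
  decreasing : weaklyDecreasing (shape N) ≡ weaklyDecreasing (shape (r ∷ T))
  decreasing = trans (cong weaklyDecreasing (shape-addColumn (b ∷ c) (r ∷ T) len)) (weaklyDecreasing-map-suc (shape (r ∷ T)))
  diagonal : (diagLength N ≡ᵇ suc n) ≡ (diagLength (r ∷ T) ≡ᵇ n)
  diagonal = cong (_≡ᵇ suc n) (trans (cong (ℕ._+ suc (length r)) (length-addColumn (b ∷ c) (r ∷ T) len))
                                     (ℕ.+-suc (length (r ∷ T)) (length r)))

length-addEmptyRow : (T : Filling) → length (addEmptyRow T) ≡ suc (length T)
length-addEmptyRow T = trans (List.length-++ T) (ℕ.+-comm (length T) 1)

shape-addEmptyRow : (T : Filling) → shape (addEmptyRow T) ≡ shape T ∷ʳ 0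
shape-addEmptyRow T = List.map-++ length T ([] ∷ [])

oneInColumn-addEmptyRow : (T : Filling) (j : ℕ) → oneInColumn (addEmptyRow T) j ≡ oneInColumn T j
oneInColumn-addEmptyRow T j = trans (any-∷ʳ (λ r → at r j) T []) (Bool.∨-identityʳ _)

ncols-addEmptyRow : (T : Filling) → ncols (addEmptyRow T) ≡ ncols T
ncols-addEmptyRow []      = refl
ncols-addEmptyRow (_ ∷ _) = refl

weaklyDecreasing-addEmptyRow : (T : Filling) → weaklyDecreasing (shape (addEmptyRow T)) ≡ weaklyDecreasing (shape T)
weaklyDecreasing-addEmptyRow []           = refl
weaklyDecreasing-addEmptyRow (r ∷ [])     = refl
weaklyDecreasing-addEmptyRow (r ∷ r′ ∷ T) = cong ((length r′ ≤ᵇ length r) ∧_) (weaklyDecreasing-addEmptyRow (r′ ∷ T))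

zeroRuleRows-addEmptyRow : (above T : Filling) → zeroRuleRows above (addEmptyRow T) ≡ zeroRuleRows above T
zeroRuleRows-addEmptyRow above []      = refl
zeroRuleRows-addEmptyRow above (r ∷ T) =
  trans (zeroRuleRows-∷ above r (addEmptyRow T))
        (trans (cong (all (zeroRuleAt above r) (indexed r) ∧_) (zeroRuleRows-addEmptyRow (above ∷ʳ r) T))
               (sym (zeroRuleRows-∷ above r T)))

isPermTableau-addEmptyRow : (n : ℕ) (T : Filling) → isPermTableau (suc n) (addEmptyRow T) ≡ isPermTableau n T
isPermTableau-addEmptyRow n T =
  cong₂ _∧_ (weaklyDecreasing-addEmptyRow T)
   (cong₂ _∧_ (cong (_≡ᵇ suc n) (cong₂ ℕ._+_ (length-addEmptyRow T) (ncols-addEmptyRow T)))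
     (cong₂ _∧_ (trans (cong (λ k → all (oneInColumn (addEmptyRow T)) (upTo k)) (ncols-addEmptyRow T))
                       (cong and (List.map-cong (oneInColumn-addEmptyRow T) (upTo (ncols T)))))
                (zeroRuleRows-addEmptyRow [] T)))

signum : ℕ → ℕ
signum zero    = 0
signum (suc _) = 1

sucIf : Bool → ℕ → ℕ
sucIf true  = suc
sucIf false = id

endsWithZero : List ℕ → Bool
endsWithZero []          = false
endsWithZero (a ∷ [])    = a ≡ᵇ 0
endsWithZero (_ ∷ b ∷ s) = endsWithZero (b ∷ s)

countSW-replicateW : (k : ℕ) (xs : List Step) → countSW (replicate k W ++ xs) ≡ countSW xs
countSW-replicateW zero    xs = refl
countSW-replicateW (suc k) xs = countSW-replicateW k xs

countSW-S-replicateW : (k : ℕ) → countSW (S ∷ replicate k W) ≡ signum k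
countSW-S-replicateW zero    = refl
countSW-S-replicateW (suc k) = cong suc (trans (cong countSW (sym (List.++-identityʳ (replicate k W))))
                                               (countSW-replicateW k []))

countSW-S-replicateW-border : (k b : ℕ) (s : List ℕ) →
  countSW (S ∷ replicate k W ++ borderFrom (b ∷ s)) ≡ signum k ℕ.+ countSW (borderFrom (b ∷ s))
countSW-S-replicateW-border zero    b []      = refl
countSW-S-replicateW-border zero    b (_ ∷ _) = refl
countSW-S-replicateW-border (suc k) b s       = cong suc (countSW-replicateW k (borderFrom (b ∷ s)))

countSW-border-∷ʳ-zero : (s : List ℕ) → countSW (borderFrom (s ∷ʳ 0)) ≡ countSW (borderFrom s)
countSW-border-∷ʳ-zero []          = refl
countSW-border-∷ʳ-zero (a ∷ [])    =
  trans (countSW-S-replicateW-border a 0 []) (trans (ℕ.+-identityʳ (signum a)) (sym (countSW-S-replicateW a)))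
countSW-border-∷ʳ-zero (a ∷ b ∷ s) =
  trans (countSW-S-replicateW-border (a ℕ.∸ b) b (s ∷ʳ 0))
        (trans (cong (signum (a ℕ.∸ b) ℕ.+_) (countSW-border-∷ʳ-zero (b ∷ s)))
               (sym (countSW-S-replicateW-border (a ℕ.∸ b) b s)))

-- Shifting all rows right keeps every corner and adds one exactly when the
-- last row was empty: its south step is now followed by a west step.
countSW-border-map-suc : (a : ℕ) (s : List ℕ) →
  countSW (borderFrom (map suc (a ∷ s))) ≡ sucIf (endsWithZero (a ∷ s)) (countSW (borderFrom (a ∷ s)))
countSW-border-map-suc zero    []      = refl
countSW-border-map-suc (suc a) []      = refl
countSW-border-map-suc a       (b ∷ s) = begin
  countSW (borderFrom (map suc (a ∷ b ∷ s)))
    ≡⟨ countSW-S-replicateW-border (a ℕ.∸ b) (suc b) (map suc s) ⟩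
  signum (a ℕ.∸ b) ℕ.+ countSW (borderFrom (map suc (b ∷ s)))
    ≡⟨ cong (signum (a ℕ.∸ b) ℕ.+_) (countSW-border-map-suc b s) ⟩
  signum (a ℕ.∸ b) ℕ.+ sucIf (endsWithZero (b ∷ s)) (countSW (borderFrom (b ∷ s)))
    ≡⟨ +-sucIf (signum (a ℕ.∸ b)) _ (endsWithZero (b ∷ s)) ⟩
  sucIf (endsWithZero (b ∷ s)) (signum (a ℕ.∸ b) ℕ.+ countSW (borderFrom (b ∷ s)))
    ≡⟨ cong (sucIf (endsWithZero (b ∷ s))) (sym (countSW-S-replicateW-border (a ℕ.∸ b) b s)) ⟩
  sucIf (endsWithZero (a ∷ b ∷ s)) (countSW (borderFrom (a ∷ b ∷ s))) ∎
  where
  open ≡-Reasoning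
  +-sucIf : ∀ m n e → m ℕ.+ sucIf e n ≡ sucIf e (m ℕ.+ n)
  +-sucIf m n true  = ℕ.+-suc m n
  +-sucIf m n false = refl

corners-addEmptyRow : (T : Filling) → corners (addEmptyRow T) ≡ corners T
corners-addEmptyRow T =
  trans (cong (countSW ∘ borderFrom) (shape-addEmptyRow T)) (countSW-border-∷ʳ-zero (shape T))

corners-addColumn : (c : List Bool) (T : Filling) → length c ≡ length T →
                    corners (addColumn c T) ≡ sucIf (endsWithZero (shape T)) (corners T)
corners-addColumn []      []      _   = refl
corners-addColumn (b ∷ c) (r ∷ T) len =
  trans (cong (countSW ∘ borderFrom) (shape-addColumn (b ∷ c) (r ∷ T) len)) (countSW-border-map-suc (length r) (shape T))

endsWithZero-∷ʳ-zero : (s : List ℕ) → endsWithZero (s ∷ʳ 0) ≡ true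
endsWithZero-∷ʳ-zero []          = refl
endsWithZero-∷ʳ-zero (a ∷ [])    = refl
endsWithZero-∷ʳ-zero (a ∷ b ∷ s) = endsWithZero-∷ʳ-zero (b ∷ s)

endsWithZero-map-suc : (s : List ℕ) → endsWithZero (map suc s) ≡ false
endsWithZero-map-suc []          = refl
endsWithZero-map-suc (a ∷ [])    = refl
endsWithZero-map-suc (a ∷ b ∷ s) = endsWithZero-map-suc (b ∷ s)

unrestrictedCount : Bool → ℕ
unrestrictedCount restricted = if restricted then 0 else 1

-- The flag s records whether the new column has a 1 above the current row.
unrestrictedRowsAfter : Bool → Filling → List Bool → Filling → ℕ
unrestrictedRowsAfter s above (b ∷ c) (r ∷ rows) =
  unrestrictedCount ((not b ∧ s) ∨ hasRestrictedZero above r) ℕ.+ unrestrictedRowsAfter (s ∨ b) (above ∷ʳ r) c rows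
unrestrictedRowsAfter _ _ _ _ = 0

unrestrictedRowsFrom-addColumn : (c′ : List Bool) (above : Filling) (c : List Bool) (rows : Filling) →
  length c′ ≡ length above → length c ≡ length rows →
  unrestrictedRowsFrom (addColumn c′ above) (addColumn c rows) ≡ unrestrictedRowsAfter (or c′) above c rows
unrestrictedRowsFrom-addColumn c′ above []      []         _    _   = refl
unrestrictedRowsFrom-addColumn c′ above (b ∷ c) (r ∷ rows) len′ len =
  cong₂ ℕ._+_ (cong unrestrictedCount (hasRestrictedZero-addColumn c′ above b r len′))
    (begin
      unrestrictedRowsFrom (addColumn c′ above ∷ʳ (b ∷ r)) (addColumn c rows)
        ≡⟨ cong (λ A → unrestrictedRowsFrom A (addColumn c rows)) (sym (addColumn-∷ʳ c′ above b r len′)) ⟩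
      unrestrictedRowsFrom (addColumn (c′ ∷ʳ b) (above ∷ʳ r)) (addColumn c rows)
        ≡⟨ unrestrictedRowsFrom-addColumn (c′ ∷ʳ b) (above ∷ʳ r) c rows (length-∷ʳ c′ above b r len′) (ℕ.suc-injective len) ⟩
      unrestrictedRowsAfter (or (c′ ∷ʳ b)) (above ∷ʳ r) c rows
        ≡⟨ cong (λ s → unrestrictedRowsAfter s (above ∷ʳ r) c rows) (or-∷ʳ c′ b) ⟩
      unrestrictedRowsAfter (or c′ ∨ b) (above ∷ʳ r) c rows ∎)
  where open ≡-Reasoning

unrestrictedRowsFrom-addEmptyRow : (above T : Filling) →
                                   unrestrictedRowsFrom above (addEmptyRow T) ≡ suc (unrestrictedRowsFrom above T)
unrestrictedRowsFrom-addEmptyRow above []      = refl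
unrestrictedRowsFrom-addEmptyRow above (r ∷ T) =
  trans (cong (unrestrictedCount (hasRestrictedZero above r) ℕ.+_) (unrestrictedRowsFrom-addEmptyRow (above ∷ʳ r) T))
        (ℕ.+-suc _ _)

extendColumns : Bool → List (List Bool) → List (List Bool) → List (List Bool)
extendColumns restricted withOne withZero =
  (if restricted then [] else map (true ∷_) withOne) ++ map (false ∷_) withZero

-- Fillings of the new first column along `rows`; s says whether it already has
-- a 1 higher up (otherwise it must get one here).
admissibleColumns : Bool → Filling → Filling → List (List Bool)
admissibleColumns s above []         = if s then [] ∷ [] else []
admissibleColumns s above (r ∷ rows) =
  extendColumns (hasRestrictedZero above r) (admissibleColumns true (above ∷ʳ r) rows) (admissibleColumns s (above ∷ʳ r) rows)

columnPolynomial : ℤ → Bool → ℕ → ℤ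
columnPolynomial z true  u = (z + + 1) ^ u
columnPolynomial z false u = z * (z + + 1) ^ u - z * z ^ u

-- Below the first 1 of the new column every unrestricted row contributes z + 1
-- (entry 1 keeps it unrestricted, entry 0 restricts it); above it, z.
∑-admissibleColumns : (z : ℤ) (s : Bool) (above rows : Filling) →
  ∑ (λ c → z ^ unrestrictedRowsAfter s above c rows) (admissibleColumns s above rows)
    ≡ columnPolynomial z s (unrestrictedRowsFrom above rows)
∑-admissibleColumns z true  above []         = refl
∑-admissibleColumns z false above []         = sym (ℤ.+-inverseʳ (z * + 1))
∑-admissibleColumns z s     above (r ∷ rows) = byEntries s (hasRestrictedZero above r) refl refl
  where
  above′ : Filling
  above′ = above ∷ʳ r
  u′ : ℕ
  u′ = unrestrictedRowsFrom above′ rows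
  columnWeight : Bool → List Bool → ℤ
  columnWeight t c = z ^ unrestrictedRowsAfter t above′ c rows
  distrib : ∀ a p → a * p + p ≡ (a + + 1) * p
  distrib = solve-∀
  distrib-minus : ∀ a p q → a * p + a * (a * p - a * q) ≡ a * ((a + + 1) * p) - a * (a * q)
  distrib-minus = solve-∀
  L : Bool → List (List Bool)
  L t = admissibleColumns t above′ rows
  IH : ∀ t → ∑ (columnWeight t) (L t) ≡ columnPolynomial z t u′
  IH t = ∑-admissibleColumns z t above′ rows
  entry : ∀ h → hasRestrictedZero above r ≡ h → (b : Bool) (cs : List (List Bool)) →
          ∑ (λ c → z ^ unrestrictedRowsAfter s above c (r ∷ rows)) (map (b ∷_) cs)
            ≡ ∑ (λ c → z ^ (unrestrictedCount ((not b ∧ s) ∨ h) ℕ.+ unrestrictedRowsAfter (s ∨ b) above′ c rows)) cs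
  entry h eq b cs = trans (∑-map _ (b ∷_) cs)
    (∑-cong cs (λ {c} _ → cong (λ h′ → z ^ (unrestrictedCount ((not b ∧ s) ∨ h′) ℕ.+ unrestrictedRowsAfter (s ∨ b) above′ c rows)) eq))
  byEntries : ∀ t h → s ≡ t → hasRestrictedZero above r ≡ h →
    ∑ (λ c → z ^ unrestrictedRowsAfter s above c (r ∷ rows)) (extendColumns h (L true) (L s))
      ≡ columnPolynomial z s (unrestrictedCount h ℕ.+ u′)
  byEntries true  true  refl eq = trans (entry true eq false (L true)) (IH true)
  byEntries false true  refl eq = trans (entry true eq false (L false)) (IH false)
  byEntries true  false refl eq =
    trans (∑-++ _ (map (true ∷_) (L true)) (map (false ∷_) (L true)))
          (trans (cong₂ _+_ (trans (entry false eq true (L true)) (trans (∑-*ˡ z (columnWeight true) (L true)) (cong (z *_) (IH true))))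
                            (trans (entry false eq false (L true)) (IH true)))
                 (distrib z ((z + + 1) ^ u′)))
  byEntries false false refl eq =
    trans (∑-++ _ (map (true ∷_) (L true)) (map (false ∷_) (L false)))
          (trans (cong₂ _+_ (trans (entry false eq true (L true)) (trans (∑-*ˡ z (columnWeight true) (L true)) (cong (z *_) (IH true))))
                            (trans (entry false eq false (L false)) (trans (∑-*ˡ z (columnWeight false) (L false)) (cong (z *_) (IH false)))))
                 (distrib-minus z ((z + + 1) ^ u′) (z ^ u′)))

module _ {L₁ L₀ : List (List Bool)} where

  []∉extendColumns : ∀ h → [] ∉ extendColumns h L₁ L₀
  []∉extendColumns true  m with ∈-map⁻ (false ∷_) m
  ... | _ , _ , ()
  []∉extendColumns false m with ∈-++⁻ (map (true ∷_) L₁) m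
  ... | inj₁ m₁ with ∈-map⁻ (true ∷_) m₁
  ...   | _ , _ , ()
  []∉extendColumns false m | inj₂ m₀ with ∈-map⁻ (false ∷_) m₀
  ...   | _ , _ , ()

  ∈-extendColumns-true⁻ : ∀ h {c} → (true ∷ c) ∈ extendColumns h L₁ L₀ → h ≡ false × c ∈ L₁
  ∈-extendColumns-true⁻ true  m with ∈-map⁻ (false ∷_) m
  ... | _ , _ , ()
  ∈-extendColumns-true⁻ false m with ∈-++⁻ (map (true ∷_) L₁) m
  ... | inj₁ m₁ with ∈-map⁻ (true ∷_) m₁
  ...   | _ , m , refl = refl , m
  ∈-extendColumns-true⁻ false m | inj₂ m₀ with ∈-map⁻ (false ∷_) m₀
  ...   | _ , _ , ()

  ∈-extendColumns-false⁻ : ∀ h {c} → (false ∷ c) ∈ extendColumns h L₁ L₀ → c ∈ L₀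
  ∈-extendColumns-false⁻ true  m with ∈-map⁻ (false ∷_) m
  ... | _ , m , refl = m
  ∈-extendColumns-false⁻ false m with ∈-++⁻ (map (true ∷_) L₁) m
  ... | inj₁ m₁ with ∈-map⁻ (true ∷_) m₁
  ...   | _ , _ , ()
  ∈-extendColumns-false⁻ false m | inj₂ m₀ with ∈-map⁻ (false ∷_) m₀
  ...   | _ , m , refl = m

  ∈-extendColumns-true⁺ : ∀ {h c} → h ≡ false → c ∈ L₁ → (true ∷ c) ∈ extendColumns h L₁ L₀
  ∈-extendColumns-true⁺ refl m = ∈-++⁺ˡ (∈-map⁺ (true ∷_) m)

  ∈-extendColumns-false⁺ : ∀ h {c} → c ∈ L₀ → (false ∷ c) ∈ extendColumns h L₁ L₀
  ∈-extendColumns-false⁺ h m = ∈-++⁺ʳ (if h then [] else map (true ∷_) L₁) (∈-map⁺ (false ∷_) m)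

  extendColumns-unique : ∀ h → Unique L₁ → Unique L₀ → Unique (extendColumns h L₁ L₀)
  extendColumns-unique true  _   L₀! = Unique.map⁺ List.∷-injectiveʳ L₀!
  extendColumns-unique false L₁! L₀! =
    Unique.++⁺ (Unique.map⁺ List.∷-injectiveʳ L₁!) (Unique.map⁺ List.∷-injectiveʳ L₀!) headsDiffer
    where
    headsDiffer : ∀ {c} → c ∈ map (true ∷_) L₁ × c ∈ map (false ∷_) L₀ → ⊥
    headsDiffer (m₁ , m₀) with ∈-map⁻ (true ∷_) m₁ | ∈-map⁻ (false ∷_) m₀
    ... | _ , _ , refl | _ , _ , ()

AdmissibleColumn : Bool → Filling → Filling → List Bool → Set
AdmissibleColumn s above rows c =
  length c ≡ length rows × (s ∨ or c) ≡ true × onesInUnrestrictedRows above c rows ≡ true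

admissibleColumns-sound : ∀ s above rows {c} → c ∈ admissibleColumns s above rows → AdmissibleColumn s above rows c
admissibleColumns-sound true  above []         (here refl) = refl , refl , refl
admissibleColumns-sound s     above (r ∷ rows) {[]}      m = ⊥-elim ([]∉extendColumns (hasRestrictedZero above r) m)
admissibleColumns-sound s     above (r ∷ rows) {true ∷ c} m
  with ∈-extendColumns-true⁻ (hasRestrictedZero above r) m
... | unrestricted , m′ with admissibleColumns-sound true (above ∷ʳ r) rows m′
...   | len , _ , ones =
  cong suc len , Bool.∨-zeroʳ s ,
  trans (cong (λ h → not h ∧ onesInUnrestrictedRows (above ∷ʳ r) c rows) unrestricted) ones
admissibleColumns-sound s     above (r ∷ rows) {false ∷ c} m
  with admissibleColumns-sound s (above ∷ʳ r) rows (∈-extendColumns-false⁻ (hasRestrictedZero above r) m)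
... | len , nonempty , ones = cong suc len , nonempty , ones

admissibleColumns-complete : ∀ s above rows c → AdmissibleColumn s above rows c → c ∈ admissibleColumns s above rows
admissibleColumns-complete true  above []         []          _                    = here refl
admissibleColumns-complete s     above (r ∷ rows) (true ∷ c)  (len , _ , ones)      =
  ∈-extendColumns-true⁺ (Bool.not-injective (Bool.∧-conicalˡ (not (hasRestrictedZero above r)) _ ones))
    (admissibleColumns-complete true (above ∷ʳ r) rows c (ℕ.suc-injective len , refl , Bool.∧-conicalʳ _ _ ones))
admissibleColumns-complete s     above (r ∷ rows) (false ∷ c) (len , nonempty , ones) =
  ∈-extendColumns-false⁺ (hasRestrictedZero above r)
    (admissibleColumns-complete s (above ∷ʳ r) rows c (ℕ.suc-injective len , nonempty , ones))

admissibleColumns-unique : ∀ s above rows → Unique (admissibleColumns s above rows)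
admissibleColumns-unique true  above []         = [] ∷ []
admissibleColumns-unique false above []         = []
admissibleColumns-unique s     above (r ∷ rows) =
  extendColumns-unique (hasRestrictedZero above r)
    (admissibleColumns-unique true (above ∷ʳ r) rows) (admissibleColumns-unique s (above ∷ʳ r) rows)

data ColumnOrEmptyRow : Filling → Set where
  emptyRow : (T : Filling) → ColumnOrEmptyRow (addEmptyRow T)
  column   : (c : List Bool) (T : Filling) → length c ≡ length T → ColumnOrEmptyRow (addColumn c T)

columnOrEmptyRow-∷ : (r : List Bool) (T : Filling) → (ncols T ≤ᵇ length r) ≡ true →
                     ColumnOrEmptyRow T → ColumnOrEmptyRow (r ∷ T)
columnOrEmptyRow-∷ r       _ _  (emptyRow T)                = emptyRow (r ∷ T)
columnOrEmptyRow-∷ []      _ _  (column []       []      _)   = emptyRow []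
columnOrEmptyRow-∷ (b ∷ r) _ _  (column []       []      _)   = column (b ∷ []) (r ∷ []) refl
columnOrEmptyRow-∷ []      _ () (column (_ ∷ _)  (_ ∷ _) _)
columnOrEmptyRow-∷ (b ∷ r) _ _  (column (b′ ∷ c) (x ∷ T) len) = column (b ∷ b′ ∷ c) (r ∷ x ∷ T) (cong suc len)

columnOrEmptyRow : (T : Filling) → weaklyDecreasing (shape T) ≡ true → ColumnOrEmptyRow T
columnOrEmptyRow []           _  = column [] [] refl
columnOrEmptyRow (r ∷ [])     _  = columnOrEmptyRow-∷ r [] refl (column [] [] refl)
columnOrEmptyRow (r ∷ r′ ∷ T) wd =
  columnOrEmptyRow-∷ r (r′ ∷ T) (Bool.∧-conicalˡ _ _ wd) (columnOrEmptyRow (r′ ∷ T) (Bool.∧-conicalʳ _ _ wd))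

columnExtensions : Filling → List Filling
columnExtensions T = map (λ c → addColumn c T) (admissibleColumns false [] T)

generatedTableaux : ℕ → List Filling
generatedTableaux zero    = [] ∷ []
generatedTableaux (suc n) = map addEmptyRow (generatedTableaux n) ++ concatMap columnExtensions (generatedTableaux n)

∈-columnExtensions⁻ : ∀ {T N} → N ∈ columnExtensions T →
                      Σ (List Bool) λ c → AdmissibleColumn false [] T c × N ≡ addColumn c T
∈-columnExtensions⁻ {T} m with ∈-map⁻ (λ c → addColumn c T) m
... | c , c∈ , refl = c , admissibleColumns-sound false [] T c∈ , refl

isPermTableau⇒weaklyDecreasing : ∀ n T → isPermTableau n T ≡ true → weaklyDecreasing (shape T) ≡ true
isPermTableau⇒weaklyDecreasing n T = Bool.∧-conicalˡ _ _

isPermTableau⇒diagLength : ∀ n T → isPermTableau n T ≡ true → (diagLength T ≡ᵇ n) ≡ true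
isPermTableau⇒diagLength n T p = Bool.∧-conicalˡ _ _ (Bool.∧-conicalʳ (weaklyDecreasing (shape T)) _ p)

generatedTableaux-sound : ∀ n {T} → T ∈ generatedTableaux n → isPermTableau n T ≡ true
generatedTableaux-sound zero    (here refl) = refl
generatedTableaux-sound (suc n) m with ∈-++⁻ (map addEmptyRow (generatedTableaux n)) m
... | inj₁ m′ with ∈-map⁻ addEmptyRow m′
...   | T , T∈ , refl = trans (isPermTableau-addEmptyRow n T) (generatedTableaux-sound n T∈)
generatedTableaux-sound (suc n) m | inj₂ m′ with find (∈-concatMap⁻ columnExtensions m′)
...   | T , T∈ , N∈ with ∈-columnExtensions⁻ N∈
...     | c , (len , nonempty , ones) , refl =
  trans (isPermTableau-addColumn n c T len)
        (trans (cong₂ (λ p q → p ∧ (q ∧ onesInUnrestrictedRows [] c T)) (generatedTableaux-sound n T∈) nonempty) ones)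

generatedTableaux-complete : ∀ n T → isPermTableau n T ≡ true → T ∈ generatedTableaux n
generatedTableaux-complete zero    []      _ = here refl
generatedTableaux-complete zero    (r ∷ T) p with () ← isPermTableau⇒diagLength zero (r ∷ T) p
generatedTableaux-complete (suc n) T       p with columnOrEmptyRow T (isPermTableau⇒weaklyDecreasing (suc n) T p)
... | emptyRow T′ =
  ∈-++⁺ˡ (∈-map⁺ addEmptyRow (generatedTableaux-complete n T′ (trans (sym (isPermTableau-addEmptyRow n T′)) p)))
... | column c T′ len =
  ∈-++⁺ʳ (map addEmptyRow (generatedTableaux n))
    (∈-concatMap⁺ columnExtensions (lose (generatedTableaux-complete n T′ tableau)
      (∈-map⁺ (λ c → addColumn c T′) (admissibleColumns-complete false [] T′ c (len , nonempty , ones)))))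
  where
  p′ : isPermTableau n T′ ∧ (or c ∧ onesInUnrestrictedRows [] c T′) ≡ true
  p′ = trans (sym (isPermTableau-addColumn n c T′ len)) p
  tableau : isPermTableau n T′ ≡ true
  tableau = Bool.∧-conicalˡ (isPermTableau n T′) _ p′
  nonempty : or c ≡ true
  nonempty = Bool.∧-conicalˡ (or c) _ (Bool.∧-conicalʳ (isPermTableau n T′) _ p′)
  ones : onesInUnrestrictedRows [] c T′ ≡ true
  ones = Bool.∧-conicalʳ (or c) _ (Bool.∧-conicalʳ (isPermTableau n T′) _ p′)

generatedTableaux-unique : ∀ n → Unique (generatedTableaux n)
generatedTableaux-unique zero    = [] ∷ []
generatedTableaux-unique (suc n) =
  Unique.++⁺ (Unique.map⁺ (λ {T} {T′} → List.∷ʳ-injectiveˡ T T′) (generatedTableaux-unique n))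
             (concatMap-unique columnExtensions (generatedTableaux-unique n) extensions-unique sameBase)
             emptyRowVsColumn
  where
  extensions-unique : ∀ {T} → T ∈ generatedTableaux n → Unique (columnExtensions T)
  extensions-unique {T} _ =
    map-unique (λ c → addColumn c T)
      (λ c∈ c′∈ → addColumn-injective T (proj₁ (admissibleColumns-sound false [] T c∈))
                                        (proj₁ (admissibleColumns-sound false [] T c′∈)))
      (admissibleColumns-unique false [] T)
  sameBase : ∀ {T T′ N} → N ∈ columnExtensions T → N ∈ columnExtensions T′ → T ≡ T′
  sameBase N∈ N∈′ with ∈-columnExtensions⁻ N∈ | ∈-columnExtensions⁻ N∈′
  ... | c , (len , _) , refl | c′ , (len′ , _) , eq =
    trans (sym (dropColumn-addColumn c _ len)) (trans (cong dropColumn eq) (dropColumn-addColumn c′ _ len′))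
  emptyRowVsColumn : ∀ {N} → N ∈ map addEmptyRow (generatedTableaux n) × N ∈ concatMap columnExtensions (generatedTableaux n) → ⊥
  emptyRowVsColumn (m , m′) with ∈-map⁻ addEmptyRow m | find (∈-concatMap⁻ columnExtensions {generatedTableaux n} m′)
  ... | T , _ , refl | T′ , _ , N∈ with ∈-columnExtensions⁻ N∈
  ...   | c , (len , _) , eq = noEmptyRow c T′ (subst ([] ∈_) eq (∈-++⁺ʳ T (here refl)))
    where
    noEmptyRow : ∀ c T → [] ∉ addColumn c T
    noEmptyRow (_ ∷ c) (_ ∷ T) (there m) = noEmptyRow c T m

module _ {X : Set} (A : List X) where

  ∈-listsOfLength : (xs : List X) → All (_∈ A) xs → xs ∈ listsOfLength A (length xs)
  ∈-listsOfLength []       []          = here refl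
  ∈-listsOfLength (x ∷ xs) (x∈A ∷ xs⊆A) =
    ∈-concatMap⁺ (λ y → map (y ∷_) (listsOfLength A (length xs)))
      (lose x∈A (∈-map⁺ (x ∷_) (∈-listsOfLength xs xs⊆A)))

  ∈-listsUpTo : (k : ℕ) (xs : List X) → length xs ≤ k → All (_∈ A) xs → xs ∈ listsUpTo A k
  ∈-listsUpTo k xs len≤k xs⊆A =
    ∈-concatMap⁺ (listsOfLength A) (lose (∈-upTo⁺ (s≤s len≤k)) (∈-listsOfLength xs xs⊆A))

  length-listsOfLength : (k : ℕ) {xs : List X} → xs ∈ listsOfLength A k → length xs ≡ k
  length-listsOfLength zero    (here refl) = refl
  length-listsOfLength (suc k) m with find (∈-concatMap⁻ (λ y → map (y ∷_) (listsOfLength A k)) {A} m)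
  ... | x , _ , m′ with ∈-map⁻ (x ∷_) m′
  ...   | xs , xs∈ , refl = cong suc (length-listsOfLength k xs∈)

  module _ (A! : Unique A) where

    listsOfLength-unique : (k : ℕ) → Unique (listsOfLength A k)
    listsOfLength-unique zero    = [] ∷ []
    listsOfLength-unique (suc k) =
      concatMap-unique (λ y → map (y ∷_) (listsOfLength A k)) A!
        (λ _ → Unique.map⁺ List.∷-injectiveʳ (listsOfLength-unique k)) sameHead
      where
      sameHead : ∀ {x x′ xs} → xs ∈ map (x ∷_) (listsOfLength A k) → xs ∈ map (x′ ∷_) (listsOfLength A k) → x ≡ x′
      sameHead m m′ with ∈-map⁻ _ m | ∈-map⁻ _ m′
      ... | _ , _ , refl | _ , _ , eq = List.∷-injectiveˡ eq

    listsUpTo-unique : (k : ℕ) → Unique (listsUpTo A k)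
    listsUpTo-unique k =
      concatMap-unique (listsOfLength A) (Unique.upTo⁺ (suc k)) (λ {j} _ → listsOfLength-unique j)
        (λ {j} {j′} m m′ → trans (sym (length-listsOfLength j m)) (length-listsOfLength j′ m′))

weaklyDecreasing⇒bounded : (a : ℕ) (s : List ℕ) → weaklyDecreasing (a ∷ s) ≡ true → All (_≤ a) s
weaklyDecreasing⇒bounded a []      _  = []
weaklyDecreasing⇒bounded a (b ∷ s) wd =
  b≤a ∷ All.map (λ c≤b → ℕ.≤-trans c≤b b≤a) (weaklyDecreasing⇒bounded b s (Bool.∧-conicalʳ (b ≤ᵇ a) _ wd))
  where
  b≤a : b ≤ a
  b≤a = ℕ.≤ᵇ⇒≤ b a (Equivalence.from Bool.T-≡ (Bool.∧-conicalˡ (b ≤ᵇ a) _ wd))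

isPermTableau⇒bounded : ∀ n T → isPermTableau n T ≡ true → length T ≤ n × All (λ r → length r ≤ n) T
isPermTableau⇒bounded n []      _ = z≤n , []
isPermTableau⇒bounded n (r ∷ T) p =
  subst (length (r ∷ T) ≤_) diag (ℕ.m≤m+n _ _) ,
  r≤n ∷ All.map (λ r′≤r → ℕ.≤-trans r′≤r r≤n)
                (All-map⁻ (weaklyDecreasing⇒bounded (length r) (shape T) (isPermTableau⇒weaklyDecreasing n (r ∷ T) p)))
  where
  diag : diagLength (r ∷ T) ≡ n
  diag = ℕ.≡ᵇ⇒≡ _ _ (Equivalence.from Bool.T-≡ (isPermTableau⇒diagLength n (r ∷ T) p))
  r≤n : length r ≤ n
  r≤n = subst (length r ≤_) diag (ℕ.m≤n+m _ _)

∈-bits : (b : Bool) → b ∈ true ∷ false ∷ []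
∈-bits true  = here refl
∈-bits false = there (here refl)

isPermTableau⇒candidate : ∀ n T → isPermTableau n T ≡ true → T ∈ candidates n
isPermTableau⇒candidate n T p =
  ∈-listsUpTo _ n T T≤n (All.map (λ {r} r≤n → ∈-listsUpTo _ n r r≤n (All.tabulate (λ {b} _ → ∈-bits b))) rows≤n)
  where
  T≤n : length T ≤ n
  T≤n = proj₁ (isPermTableau⇒bounded n T p)
  rows≤n : All (λ r → length r ≤ n) T
  rows≤n = proj₂ (isPermTableau⇒bounded n T p)

∈-permTableaux⁺ : ∀ n T → isPermTableau n T ≡ true → T ∈ permTableaux n
∈-permTableaux⁺ n T p = ∈-filter⁺ (λ T → T? (isPermTableau n T)) (isPermTableau⇒candidate n T p) (Equivalence.from Bool.T-≡ p)

∈-permTableaux⁻ : ∀ n {T} → T ∈ permTableaux n → isPermTableau n T ≡ true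
∈-permTableaux⁻ n m = Equivalence.to Bool.T-≡ (proj₂ (∈-filter⁻ (λ T → T? (isPermTableau n T)) {xs = candidates n} m))

permTableaux-unique : ∀ n → Unique (permTableaux n)
permTableaux-unique n =
  Unique.filter⁺ (λ T → T? (isPermTableau n T))
    (listsUpTo-unique _ (listsUpTo-unique (true ∷ false ∷ []) (((λ ()) ∷ []) ∷ [] ∷ []) n) n)

weight : ℤ → ℤ → Filling → ℤ
weight x z T = x ^ corners T * z ^ unrestrictedRows T

C≡∑generatedTableaux : ∀ n x z → C n x z ≡ ∑ (weight x z) (generatedTableaux n)
C≡∑generatedTableaux n x z =
  ∑-unique (weight x z) (permTableaux-unique n) (generatedTableaux-unique n)
    (λ m → generatedTableaux-complete n _ (∈-permTableaux⁻ n m))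
    (λ m → ∈-permTableaux⁺ n _ (generatedTableaux-sound n m))

weight-addEmptyRow : ∀ x z T → weight x z (addEmptyRow T) ≡ x ^ corners T * (z * z ^ unrestrictedRows T)
weight-addEmptyRow x z T =
  cong₂ (λ k u → x ^ k * z ^ u) (corners-addEmptyRow T) (unrestrictedRowsFrom-addEmptyRow [] T)

∑-columnExtensions : ∀ x z T → ∑ (weight x z) (columnExtensions T)
  ≡ x ^ sucIf (endsWithZero (shape T)) (corners T) * columnPolynomial z false (unrestrictedRows T)
∑-columnExtensions x z T = begin
  ∑ (weight x z) (columnExtensions T)
    ≡⟨ ∑-map (weight x z) (λ c → addColumn c T) columns ⟩
  ∑ (λ c → weight x z (addColumn c T)) columns
    ≡⟨ ∑-cong columns (λ {c} c∈ → cong₂ (λ k u → x ^ k * z ^ u) (corners-addColumn c T (length≡ c∈))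
                                        (unrestrictedRowsFrom-addColumn [] [] c T refl (length≡ c∈))) ⟩
  ∑ (λ c → x ^ k′ * z ^ unrestrictedRowsAfter false [] c T) columns
    ≡⟨ ∑-*ˡ (x ^ k′) _ columns ⟩
  x ^ k′ * ∑ (λ c → z ^ unrestrictedRowsAfter false [] c T) columns
    ≡⟨ cong (x ^ k′ *_) (∑-admissibleColumns z false [] T) ⟩
  x ^ k′ * columnPolynomial z false (unrestrictedRows T) ∎
  where
  open ≡-Reasoning
  columns : List (List Bool)
  columns = admissibleColumns false [] T
  k′ : ℕ
  k′ = sucIf (endsWithZero (shape T)) (corners T)
  length≡ : ∀ {c} → c ∈ columns → length c ≡ length T
  length≡ c∈ = proj₁ (admissibleColumns-sound false [] T c∈)

emptyLastRowTerm : ℤ → ℤ → Filling → ℤ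
emptyLastRowTerm x z T =
  if endsWithZero (shape T) then z * weight x (z + + 1) T - z * weight x z T else + 0

∑-generatedTableaux-suc : ∀ n x z → ∑ (weight x z) (generatedTableaux (suc n))
  ≡ z * ∑ (weight x (z + + 1)) (generatedTableaux n) + (x - + 1) * ∑ (emptyLastRowTerm x z) (generatedTableaux n)
∑-generatedTableaux-suc n x z = begin
  ∑ (weight x z) (map addEmptyRow G ++ concatMap columnExtensions G)
    ≡⟨ ∑-++ (weight x z) (map addEmptyRow G) (concatMap columnExtensions G) ⟩
  ∑ (weight x z) (map addEmptyRow G) + ∑ (weight x z) (concatMap columnExtensions G)
    ≡⟨ cong₂ _+_ (∑-map (weight x z) addEmptyRow G) (∑-concatMap (weight x z) columnExtensions G) ⟩
  ∑ (weight x z ∘ addEmptyRow) G + ∑ (∑ (weight x z) ∘ columnExtensions) G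
    ≡⟨ sym (∑-+ (weight x z ∘ addEmptyRow) (∑ (weight x z) ∘ columnExtensions) G) ⟩
  ∑ (λ T → weight x z (addEmptyRow T) + ∑ (weight x z) (columnExtensions T)) G
    ≡⟨ ∑-cong G (λ {T} _ → trans (cong₂ _+_ (weight-addEmptyRow x z T) (∑-columnExtensions x z T))
                                 (perTableau (corners T) (unrestrictedRows T) (endsWithZero (shape T)))) ⟩
  ∑ (λ T → z * weight x (z + + 1) T + (x - + 1) * emptyLastRowTerm x z T) G
    ≡⟨ ∑-+ (λ T → z * weight x (z + + 1) T) (λ T → (x - + 1) * emptyLastRowTerm x z T) G ⟩
  ∑ (λ T → z * weight x (z + + 1) T) G + ∑ (λ T → (x - + 1) * emptyLastRowTerm x z T) G
    ≡⟨ cong₂ _+_ (∑-*ˡ z (weight x (z + + 1)) G) (∑-*ˡ (x - + 1) (emptyLastRowTerm x z) G) ⟩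
  z * ∑ (weight x (z + + 1)) G + (x - + 1) * ∑ (emptyLastRowTerm x z) G ∎
  where
  open ≡-Reasoning
  G : List Filling
  G = generatedTableaux n
  newCorner : ∀ x z X P Q → X * (z * Q) + (x * X) * (z * P - z * Q) ≡ z * (X * P) + (x - + 1) * (z * (X * P) - z * (X * Q))
  newCorner = solve-∀
  noNewCorner : ∀ x z X P Q → X * (z * Q) + X * (z * P - z * Q) ≡ z * (X * P) + (x - + 1) * + 0
  noNewCorner = solve-∀
  perTableau : ∀ k u e → x ^ k * (z * z ^ u) + x ^ sucIf e k * columnPolynomial z false u
    ≡ z * (x ^ k * (z + + 1) ^ u) + (x - + 1) * (if e then z * (x ^ k * (z + + 1) ^ u) - z * (x ^ k * z ^ u) else + 0)
  perTableau k u true  = newCorner x z (x ^ k) ((z + + 1) ^ u) (z ^ u)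
  perTableau k u false = noNewCorner x z (x ^ k) ((z + + 1) ^ u) (z ^ u)

emptyLastRowTerm-addColumn : ∀ x z c T → length c ≡ length T → emptyLastRowTerm x z (addColumn c T) ≡ + 0
emptyLastRowTerm-addColumn x z c T len =
  cong (λ e → if e then z * weight x (z + + 1) (addColumn c T) - z * weight x z (addColumn c T) else + 0)
       (trans (cong endsWithZero (shape-addColumn c T len)) (endsWithZero-map-suc (shape T)))

emptyLastRowTerm-addEmptyRow : ∀ x z T →
  emptyLastRowTerm x z (addEmptyRow T) ≡ z * (z + + 1) * weight x (z + + 1) T + (- (z * z)) * weight x z T
emptyLastRowTerm-addEmptyRow x z T = begin
  emptyLastRowTerm x z (addEmptyRow T)
    ≡⟨ cong (λ e → if e then z * weight x (z + + 1) (addEmptyRow T) - z * weight x z (addEmptyRow T) else + 0)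
            (trans (cong endsWithZero (shape-addEmptyRow T)) (endsWithZero-∷ʳ-zero (shape T))) ⟩
  z * weight x (z + + 1) (addEmptyRow T) - z * weight x z (addEmptyRow T)
    ≡⟨ cong₂ (λ A B → z * A - z * B) (weight-addEmptyRow x (z + + 1) T) (weight-addEmptyRow x z T) ⟩
  z * (x ^ corners T * ((z + + 1) * (z + + 1) ^ unrestrictedRows T)) - z * (x ^ corners T * (z * z ^ unrestrictedRows T))
    ≡⟨ regroup z (x ^ corners T) ((z + + 1) ^ unrestrictedRows T) (z ^ unrestrictedRows T) ⟩
  z * (z + + 1) * weight x (z + + 1) T + (- (z * z)) * weight x z T ∎
  where
  open ≡-Reasoning
  regroup : ∀ z X P Q → z * (X * ((z + + 1) * P)) - z * (X * (z * Q)) ≡ z * (z + + 1) * (X * P) + (- (z * z)) * (X * Q)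
  regroup = solve-∀

∑-emptyLastRowTerm-suc : ∀ m x z → ∑ (emptyLastRowTerm x z) (generatedTableaux (suc m))
  ≡ z * (z + + 1) * ∑ (weight x (z + + 1)) (generatedTableaux m) - z * z * ∑ (weight x z) (generatedTableaux m)
∑-emptyLastRowTerm-suc m x z = begin
  ∑ (emptyLastRowTerm x z) (map addEmptyRow G ++ concatMap columnExtensions G)
    ≡⟨ ∑-++ (emptyLastRowTerm x z) (map addEmptyRow G) (concatMap columnExtensions G) ⟩
  ∑ (emptyLastRowTerm x z) (map addEmptyRow G) + ∑ (emptyLastRowTerm x z) (concatMap columnExtensions G)
    ≡⟨ cong₂ _+_ (∑-map (emptyLastRowTerm x z) addEmptyRow G)
                 (trans (∑-concatMap (emptyLastRowTerm x z) columnExtensions G)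
                        (trans (∑-cong G (λ {T} _ → vanishesOnColumns T)) (∑-zero G))) ⟩
  ∑ (emptyLastRowTerm x z ∘ addEmptyRow) G + + 0
    ≡⟨ ℤ.+-identityʳ _ ⟩
  ∑ (emptyLastRowTerm x z ∘ addEmptyRow) G
    ≡⟨ ∑-cong G (λ {T} _ → emptyLastRowTerm-addEmptyRow x z T) ⟩
  ∑ (λ T → z * (z + + 1) * weight x (z + + 1) T + (- (z * z)) * weight x z T) G
    ≡⟨ ∑-+ _ _ G ⟩
  ∑ (λ T → z * (z + + 1) * weight x (z + + 1) T) G + ∑ (λ T → (- (z * z)) * weight x z T) G
    ≡⟨ cong₂ _+_ (∑-*ˡ (z * (z + + 1)) (weight x (z + + 1)) G) (∑-*ˡ (- (z * z)) (weight x z) G) ⟩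
  z * (z + + 1) * ∑ (weight x (z + + 1)) G + (- (z * z)) * ∑ (weight x z) G
    ≡⟨ cong (_+_ (z * (z + + 1) * ∑ (weight x (z + + 1)) G)) (sym (ℤ.neg-distribˡ-* (z * z) _)) ⟩
  z * (z + + 1) * ∑ (weight x (z + + 1)) G - z * z * ∑ (weight x z) G ∎
  where
  open ≡-Reasoning
  G : List Filling
  G = generatedTableaux m
  vanishesOnColumns : ∀ T → ∑ (emptyLastRowTerm x z) (columnExtensions T) ≡ + 0
  vanishesOnColumns T =
    trans (∑-map (emptyLastRowTerm x z) (λ c → addColumn c T) columns)
          (trans (∑-cong columns (λ {c} c∈ → emptyLastRowTerm-addColumn x z c T (proj₁ (admissibleColumns-sound false [] T c∈))))
                 (∑-zero columns))
    where
    columns : List (List Bool)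
    columns = admissibleColumns false [] T

proposition3p1 :
    ((x z : ℤ) → C 1 x z ≡ z) ×
    ((m : ℕ) (x z : ℤ) →
      C (2 Data.Nat.+ m) x z ≡
        z * C (1 Data.Nat.+ m) x (z + + 1)
        + (x - + 1) * (z * (z + + 1) * C m x (z + + 1) - z * z * C m x z))
proposition3p1 = lengthOne , recurrence
  where
  lengthOne : (x z : ℤ) → C 1 x z ≡ z
  lengthOne x z = trans (C≡∑generatedTableaux 1 x z) (trans (ℤ.+-identityʳ _) (trans (ℤ.*-identityˡ _) (ℤ.*-identityʳ z)))
  recurrence : (m : ℕ) (x z : ℤ) → C (2 ℕ.+ m) x z
    ≡ z * C (1 ℕ.+ m) x (z + + 1) + (x - + 1) * (z * (z + + 1) * C m x (z + + 1) - z * z * C m x z)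
  recurrence m x z = begin
    C (2 ℕ.+ m) x z
      ≡⟨ C≡∑generatedTableaux (2 ℕ.+ m) x z ⟩
    ∑ (weight x z) (generatedTableaux (2 ℕ.+ m))
      ≡⟨ ∑-generatedTableaux-suc (suc m) x z ⟩
    z * ∑ (weight x (z + + 1)) (generatedTableaux (suc m)) + (x - + 1) * ∑ (emptyLastRowTerm x z) (generatedTableaux (suc m))
      ≡⟨ cong₂ (λ A B → z * A + (x - + 1) * B) (sym (C≡∑generatedTableaux (suc m) x (z + + 1))) (∑-emptyLastRowTerm-suc m x z) ⟩
    z * C (1 ℕ.+ m) x (z + + 1)
      + (x - + 1) * (z * (z + + 1) * ∑ (weight x (z + + 1)) (generatedTableaux m) - z * z * ∑ (weight x z) (generatedTableaux m))
      ≡⟨ cong₂ (λ A B → z * C (1 ℕ.+ m) x (z + + 1) + (x - + 1) * (z * (z + + 1) * A - z * z * B))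
               (sym (C≡∑generatedTableaux m x (z + + 1))) (sym (C≡∑generatedTableaux m x z)) ⟩
    z * C (1 ℕ.+ m) x (z + + 1) + (x - + 1) * (z * (z + + 1) * C m x (z + + 1) - z * z * C m x z) ∎
    where open ≡-Reasoning
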